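{- Let $m\ge 2$ and $n\ge 2$. Let $\alpha=\alpha_1\cdots\alpha_{2m}\in\mathcal{C}_{2m}(123)$ with $\{\alpha_1,\dots,\alpha_m\}=\{m+1,\dots,2m\}$, and let $\beta=\beta_1\cdots\beta_n\in\mathcal{C}_n(123)$. Define $$\alpha\star\beta=\bar\alpha_1\cdots\bar\alpha_{m-1}\,\bar\beta_1\cdots\bar\beta_n\,\alpha_{m+2}\alpha_{m+3}\cdots\alpha_{2m}\in S_{n+2m-2},$$ where $\bar\alpha_i=\alpha_i+n-2$, and $\bar\beta_i=\alpha_m+n-2$ if $\beta_i=n$, $\bar\beta_i=\alpha_{m+1}$ if $\beta_i=1$, and $\bar\beta_i=\beta_i+m-1$ otherwise. Then $\alpha\star\beta\in\mathcal{C}_{n+2m-2}(123)$.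
   Context: $\mathcal{C}_n(123)$ is the set of permutations of $[n]$ in one-line notation that consist of a single $n$-cycle and avoid the pattern $123$ (contain no increasing subsequence of length $3$). -}

module Defs where

open import Data.Nat using (ℕ; zero; suc; _+_; _∸_; _≤_; _<_; _≟_; _≤?_)
open import Data.Product using (Σ; ∃; _×_; _,_)
open import Relation.Nullary using (¬_; yes; no)
open import Relation.Binary.PropositionalEquality using (_≡_)

-- A word/permutation in one-line notation is a function w : ℕ → ℕ, where
-- position i (1 ≤ i ≤ N) holds the letter w i.  Only positions 1..N matter.

IsPerm : ℕ → (ℕ → ℕ) → Set
IsPerm N w =
  (∀ i → 1 ≤ i → i ≤ N → 1 ≤ w i × w i ≤ N) ×
  (∀ i j → 1 ≤ i → i ≤ N → 1 ≤ j → j ≤ N → w i ≡ w j → i ≡ j)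

iter : ℕ → (ℕ → ℕ) → ℕ → ℕ
iter zero    w x = x
iter (suc k) w x = w (iter k w x)

IsCycle : ℕ → (ℕ → ℕ) → Set
IsCycle N w = ∀ i → 1 ≤ i → i ≤ N → ∃ λ k → iter k w 1 ≡ i

Avoids123 : ℕ → (ℕ → ℕ) → Set
Avoids123 N w =
  ¬ (Σ ℕ λ i → Σ ℕ λ j → Σ ℕ λ k →
       1 ≤ i × i < j × j < k × k ≤ N × w i < w j × w j < w k)

InC123 : ℕ → (ℕ → ℕ) → Set
InC123 N w = IsPerm N w × IsCycle N w × Avoids123 N w

βbar : (m n : ℕ) → (α β : ℕ → ℕ) → ℕ → ℕ
βbar m n α β i with β i ≟ n
... | yes _ = α m + (n ∸ 2)
... | no _ with β i ≟ 1
...   | yes _ = α (suc m)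
...   | no _  = β i + (m ∸ 1)

star : (m n : ℕ) → (α β : ℕ → ℕ) → ℕ → ℕ
star m n α β p with suc p ≤? m
... | yes _ = α p + (n ∸ 2)                          -- 1 ≤ p ≤ m-1
... | no _ with suc p ≤? m + n
...   | yes _ = βbar m n α β (p ∸ (m ∸ 1))           -- m ≤ p ≤ m+n-1
...   | no _  = α (p ∸ n + 2)                        -- p ≥ m+n

-- Write m = e + 1, n = d + 2 and σ = α ⋆ β, a word on [N] with N = d + 2m.  Its
-- positions are of five kinds (front 1..e; the β-block e+1..e+n, split by whether
-- β_b is n, 1 or neither; back), and its values fall into three bands: low [1, m],
-- the α_q with q > m; middle [m+1, m+d], the shifted β-letters other than 1 and n;
-- high [m+d+1, N], the α_i + d with i ≤ m.  Values in different bands differ and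
-- grow with the band, so injectivity is checked band by band, and a 123-pattern in
-- σ with middle entry in the front or back yields one in α, while one with middle
-- entry inside the β-block yields one in β.
-- For the cycle, let τ fix [1, m] and shift [m+1, 2m] by d.  Then σ ∘ τ = τ ∘ α
-- except at m and m+1, which τ sends to the two ends e+1 and e+n of the β-block;
-- from there σ follows the cycle β from 1 to n (resp. from n to 1) and then lands on
-- τ (α m) (resp. τ (α (m+1))).  Hence the σ-orbit of 1 contains τ of the α-orbit of
-- 1, and from the two block ends it sweeps the whole β-block.

module Submission where

open import Defs
open import Data.Nat
open import Data.Nat.Properties
open import Data.Nat.Induction using (<-wellFounded)
open import Data.Nat.Tactic.RingSolver using (solve-∀)
open import Data.Fin using (toℕ; fromℕ<)
import Data.Fin.Properties as Fin
open import Data.Product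
open import Data.Sum using (inj₁; inj₂)
open import Data.Empty using (⊥; ⊥-elim)
open import Data.Unit using (⊤; tt)
open import Function using (_∘_)
open import Induction.WellFounded using (Acc; acc)
open import Relation.Nullary using (yes; no; ¬_; contradiction)
open import Relation.Unary using (Decidable)
open import Relation.Binary.PropositionalEquality

-- Orbits

Reaches : (ℕ → ℕ) → ℕ → ℕ → Set
Reaches w x y = ∃ λ k → iter k w x ≡ y

iter-+ : ∀ (w : ℕ → ℕ) k l x → iter (k + l) w x ≡ iter k w (iter l w x)
iter-+ w zero    l x = refl
iter-+ w (suc k) l x = cong w (iter-+ w k l x)

iter-* : ∀ (w : ℕ → ℕ) {P x} → iter P w x ≡ x → ∀ c → iter (c * P) w x ≡ x
iter-* w         fixed zero    = refl
iter-* w {P} {x} fixed (suc c) = begin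
  iter (P + c * P) w x        ≡⟨ iter-+ w P (c * P) x ⟩
  iter P w (iter (c * P) w x) ≡⟨ cong (iter P w) (iter-* w fixed c) ⟩
  iter P w x                  ≡⟨ fixed ⟩
  x                           ∎
  where open ≡-Reasoning

reaches-refl : ∀ {w x} → Reaches w x x
reaches-refl = 0 , refl

reaches-step : ∀ {w x y} → Reaches w x y → Reaches w x (w y)
reaches-step (k , eq) = suc k , cong _ eq

reaches-trans : ∀ {w x y z} → Reaches w x y → Reaches w y z → Reaches w x z
reaches-trans {w} {x} (k , refl) (l , refl) = l + k , iter-+ w l k x

module _ {P : ℕ → Set} (P? : Decidable P) where

  least-witness : ∀ {K} → P K → ∃ λ k → P k × (∀ {i} → i < k → ¬ P i)
  least-witness {K} = go (<-wellFounded K)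
    where
    go : ∀ {K} → Acc _<_ K → P K → ∃ λ k → P k × (∀ {i} → i < k → ¬ P i)
    go {K} (acc smaller) pK with anyUpTo? P? K
    ... | yes (i , i<K , pi) = go (smaller i<K) pi
    ... | no none            = K , pK , λ i<K pi → none (_ , i<K , pi)

first-visit : ∀ (w : ℕ → ℕ) {s t} → s ≢ t → Reaches w s t →
  ∃ λ k → iter (suc k) w s ≡ t × (∀ i → i < k → iter (suc i) w s ≢ s × iter (suc i) w s ≢ t)
first-visit w {s} {t} s≢t (T , hit) with least-witness (λ T → iter T w s ≟ t) {T} hit
... | zero  , s≡t , _       = ⊥-elim (s≢t s≡t)
... | suc k , hit′ , earlier = k , hit′ , λ i i<k → no-return i i<k , earlier (s<s i<k)
  where
  -- a return to s at time suc i would let t be reached already at time k ∸ i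
  no-return : ∀ i → i < k → iter (suc i) w s ≢ s
  no-return i i<k back = earlier (s<s (m∸n≤m k i)) (begin
    iter (k ∸ i) w s                      ≡⟨ cong (iter (k ∸ i) w) back ⟨
    iter (k ∸ i) w (iter (suc i) w s)     ≡⟨ iter-+ w (k ∸ i) (suc i) s ⟨
    iter (k ∸ i + suc i) w s              ≡⟨ cong (λ T → iter T w s) (m∸n+n≡m (s≤s (<⇒≤ i<k))) ⟩
    iter (suc k) w s                      ≡⟨ hit′ ⟩
    t                                     ∎)
    where open ≡-Reasoning

iter-closed : ∀ {K} {w : ℕ → ℕ} → (∀ i → 1 ≤ i → i ≤ K → 1 ≤ w i × w i ≤ K) →
  ∀ {x} → 1 ≤ x → x ≤ K → ∀ k → 1 ≤ iter k w x × iter k w x ≤ K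
iter-closed closed 1≤x x≤K zero    = 1≤x , x≤K
iter-closed closed 1≤x x≤K (suc k) = uncurry (closed _) (iter-closed closed 1≤x x≤K k)

iter-cancel : ∀ {K w} → IsPerm K w → ∀ {x} → 1 ≤ x → x ≤ K →
  ∀ a c → iter (a + c) w x ≡ iter a w x → iter c w x ≡ x
iter-cancel perm 1≤x x≤K zero    c eq = eq
iter-cancel {K} {w} (closed , injective) {x} 1≤x x≤K (suc a) c eq =
  iter-cancel (closed , injective) 1≤x x≤K a c
    (injective _ _ (proj₁ after) (proj₂ after) (proj₁ before) (proj₂ before) eq)
  where
  after : 1 ≤ iter (a + c) w x × iter (a + c) w x ≤ K
  after = iter-closed closed 1≤x x≤K (a + c)
  before : 1 ≤ iter a w x × iter a w x ≤ K
  before = iter-closed closed 1≤x x≤K a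

pred<-bound : ∀ {y K} → 1 ≤ y × y ≤ K → pred y < K
pred<-bound {suc y} (_ , y<K) = y<K

orbit-repeats : ∀ {K} {w : ℕ → ℕ} {x} → (∀ k → 1 ≤ iter k w x × iter k w x ≤ K) →
  ∃₂ λ i j → i < j × iter i w x ≡ iter j w x
orbit-repeats {K} {w} {x} bounds
  with i , j , i<j , same ← Fin.pigeonhole (n<1+n K) (λ t → fromℕ< (pred<-bound (bounds (toℕ t))))
  = toℕ i , toℕ j , i<j ,
    pred-injective {{>-nonZero (proj₁ (bounds (toℕ i)))}} {{>-nonZero (proj₁ (bounds (toℕ j)))}}
      (trans (sym (Fin.toℕ-fromℕ< _)) (trans (cong toℕ same) (Fin.toℕ-fromℕ< _)))

perm-periodic : ∀ {K w} → IsPerm K w → ∀ {x} → 1 ≤ x → x ≤ K → ∃ λ P → iter (suc P) w x ≡ x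
perm-periodic {w = w} perm {x} 1≤x x≤K
  with i , j , i<j , same ← orbit-repeats (iter-closed (proj₁ perm) 1≤x x≤K)
  with P , refl ← m≤n⇒∃[o]m+o≡n i<j
  = P , iter-cancel perm 1≤x x≤K i (suc P)
          (trans (cong (λ T → iter T w x) (+-suc i P)) (sym same))

reaches-sym : ∀ {K w} → IsPerm K w → ∀ {x y} → 1 ≤ x → x ≤ K → Reaches w x y → Reaches w y x
reaches-sym {w = w} perm {x} 1≤x x≤K (k , refl) with P , period ← perm-periodic perm 1≤x x≤K =
  k * P , (begin
    iter (k * P) w (iter k w x) ≡⟨ iter-+ w (k * P) k x ⟨
    iter (k * P + k) w x        ≡⟨ cong (λ T → iter T w x) (trans (+-comm (k * P) k) (sym (*-suc k P))) ⟩
    iter (k * suc P) w x        ≡⟨ iter-* w period k ⟩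
    x                           ∎)
  where open ≡-Reasoning

-- Evaluating α ⋆ β

βbar-top : ∀ m n α β b → β b ≡ n → βbar m n α β b ≡ α m + (n ∸ 2)
βbar-top m n α β b βb≡n with β b ≟ n
... | yes _   = refl
... | no βb≢n = contradiction βb≡n βb≢n

βbar-bottom : ∀ m n α β b → n ≢ 1 → β b ≡ 1 → βbar m n α β b ≡ α (suc m)
βbar-bottom m n α β b n≢1 βb≡1 with β b ≟ n
... | yes βb≡n = contradiction (trans (sym βb≡1) βb≡n) (n≢1 ∘ sym)
... | no _ with β b ≟ 1
...   | yes _   = refl
...   | no βb≢1 = contradiction βb≡1 βb≢1

βbar-inner : ∀ m n α β b → β b ≢ n → β b ≢ 1 → βbar m n α β b ≡ β b + (m ∸ 1)
βbar-inner m n α β b βb≢n βb≢1 with β b ≟ n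
... | yes βb≡n = contradiction βb≡n βb≢n
... | no _ with β b ≟ 1
...   | yes βb≡1 = contradiction βb≡1 βb≢1
...   | no _     = refl

star-front : ∀ m n α β p → p < m → star m n α β p ≡ α p + (n ∸ 2)
star-front m n α β p p<m with suc p ≤? m
... | yes _  = refl
... | no p≮m = contradiction p<m p≮m

star-block : ∀ e n α β b → 1 ≤ b → b ≤ n → star (suc e) n α β (e + b) ≡ βbar (suc e) n α β b
star-block e n α β b 1≤b b≤n with suc (e + b) ≤? suc e
... | yes inFront = contradiction (s≤s⁻¹ inFront) (<⇒≱ (m<m+n e 1≤b))
... | no _ with suc (e + b) ≤? suc e + n
...   | yes _ = cong (βbar (suc e) n α β) (m+n∸m≡n e b)
...   | no beyond = contradiction (s≤s (+-monoʳ-≤ e b≤n)) beyond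

star-back : ∀ m d α β q → suc (suc m) ≤ q → star m (suc (suc d)) α β (q + d) ≡ α q
star-back m d α β (suc (suc q)) (s≤s (s≤s m≤q)) with suc (suc (suc q) + d) ≤? m
... | yes inFront = contradiction inFront (<⇒≱ (s≤s (≤-trans m≤q+d (≤-trans (n≤1+n _) (n≤1+n _)))))
  where
  m≤q+d : m ≤ q + d
  m≤q+d = ≤-trans m≤q (m≤m+n q d)
... | no _ with suc (suc (suc q) + d) ≤? m + suc (suc d)
...   | yes inBlock = contradiction inBlock (<⇒≱ (s≤s blockEnd))
  where
  blockEnd : m + suc (suc d) ≤ suc (suc (q + d))
  blockEnd = ≤-trans (≤-reflexive (trans (+-suc m (suc d)) (cong suc (+-suc m d))))
                     (s≤s (s≤s (+-monoˡ-≤ d m≤q)))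
...   | no _ = cong α (trans (cong (_+ 2) (m+n∸n≡m q d)) (+-comm q 2))

back-offset : ∀ e d k → suc (suc (suc (e + k))) + d ≡ suc (e + suc (suc d)) + k
back-offset = solve-∀

-- Positions and bands

data Level : Set where
  low mid high : Level

-- The inverted pairs reduce to ⊥, so impossible band orders are absurd patterns.
_≤ᴸ_ : Level → Level → Set
high ≤ᴸ low = ⊥
high ≤ᴸ mid = ⊥
mid  ≤ᴸ low = ⊥
_    ≤ᴸ _   = ⊤

≤ᴸ-antisym : ∀ {ℓ ℓ′} → ℓ ≤ᴸ ℓ′ → ℓ′ ≤ᴸ ℓ → ℓ ≡ ℓ′
≤ᴸ-antisym {low}  {low}  _ _ = refl
≤ᴸ-antisym {mid}  {mid}  _ _ = refl
≤ᴸ-antisym {high} {high} _ _ = refl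
≤ᴸ-antisym {low}  {mid}  _ ()
≤ᴸ-antisym {low}  {high} _ ()
≤ᴸ-antisym {mid}  {high} _ ()
≤ᴸ-antisym {mid}  {low}  ()
≤ᴸ-antisym {high} {low}  ()
≤ᴸ-antisym {high} {mid}  ()

module StarOfCycles
  (e d : ℕ) (α β : ℕ → ℕ)
  (α-perm : IsPerm (2 * suc e) α) (α-cycle : IsCycle (2 * suc e) α) (α-avoids : Avoids123 (2 * suc e) α)
  (α-high : ∀ i → 1 ≤ i → i ≤ suc e → suc (suc e) ≤ α i × α i ≤ 2 * suc e)
  (α-onto : ∀ v → suc (suc e) ≤ v → v ≤ 2 * suc e → ∃ λ i → 1 ≤ i × i ≤ suc e × α i ≡ v)
  (β-perm : IsPerm (suc (suc d)) β) (β-cycle : IsCycle (suc (suc d)) β) (β-avoids : Avoids123 (suc (suc d)) β)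
  where

  m n N : ℕ
  m = suc e
  n = suc (suc d)
  N = d + 2 * m

  σ : ℕ → ℕ
  σ = star m n α β

  m+d≤N : m + d ≤ N
  m+d≤N = subst (m + d ≤_) (+-comm (2 * m) d) (+-monoˡ-≤ d (m≤m+n m (m + 0)))

  m<2m : m < 2 * m
  m<2m = m<m+n m (s≤s z≤n)

  e+n≡m+1+d : e + n ≡ suc m + d
  e+n≡m+1+d = trans (+-suc e (suc d)) (cong suc (+-suc e d))

  data Band : Level → ℕ → Set where
    low  : ∀ {v} → 1 ≤ v → v ≤ m → Band low v
    mid  : ∀ {v} → m < v → v ≤ m + d → Band mid v
    high : ∀ {v} → m + d < v → v ≤ N → Band high v

  band-mono : ∀ {ℓ ℓ′ v w} → v ≤ w → Band ℓ v → Band ℓ′ w → ℓ ≤ᴸ ℓ′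
  band-mono _   (low _ _)      _              = tt
  band-mono _   (mid _ _)      (mid _ _)      = tt
  band-mono _   (mid _ _)      (high _ _)     = tt
  band-mono _   (high _ _)     (high _ _)     = tt
  band-mono v≤w (mid m<v _)    (low _ w≤m)    = <⇒≱ m<v (≤-trans v≤w w≤m)
  band-mono v≤w (high m+d<v _) (mid _ w≤m+d)  = <⇒≱ m+d<v (≤-trans v≤w w≤m+d)
  band-mono v≤w (high m+d<v _) (low _ w≤m)    =
    <⇒≱ (≤-<-trans (m≤m+n m d) m+d<v) (≤-trans v≤w w≤m)

  band-unique : ∀ {ℓ ℓ′ v} → Band ℓ v → Band ℓ′ v → ℓ ≡ ℓ′
  band-unique x y = ≤ᴸ-antisym (band-mono ≤-refl x y) (band-mono ≤-refl y x)

  band-bounds : ∀ {ℓ v} → Band ℓ v → 1 ≤ v × v ≤ N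
  band-bounds (low 1≤v v≤m)    = 1≤v , ≤-trans v≤m (≤-trans (m≤m+n m d) m+d≤N)
  band-bounds (mid m<v v≤m+d)  = ≤-trans (s≤s z≤n) m<v , ≤-trans v≤m+d m+d≤N
  band-bounds (high m+d<v v≤N) = ≤-trans (s≤s z≤n) m+d<v , v≤N

  α-range : ∀ i → 1 ≤ i → i ≤ 2 * m → 1 ≤ α i × α i ≤ 2 * m
  α-range = proj₁ α-perm

  α-injective : ∀ i j → 1 ≤ i → i ≤ 2 * m → 1 ≤ j → j ≤ 2 * m → α i ≡ α j → i ≡ j
  α-injective = proj₂ α-perm

  β-range : ∀ b → 1 ≤ b → b ≤ n → 1 ≤ β b × β b ≤ n
  β-range = proj₁ β-perm

  β-injective : ∀ b b′ → 1 ≤ b → b ≤ n → 1 ≤ b′ → b′ ≤ n → β b ≡ β b′ → b ≡ b′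
  β-injective = proj₂ β-perm

  α-low : ∀ q → m < q → q ≤ 2 * m → 1 ≤ α q × α q ≤ m
  α-low q m<q q≤2m with α-range q (≤-trans (s≤s z≤n) m<q) q≤2m
  ... | 1≤αq , αq≤2m with m <? α q
  ...   | no αq≯m = 1≤αq , ≮⇒≥ αq≯m
  ...   | yes m<αq with i , 1≤i , i≤m , same ← α-onto (α q) m<αq αq≤2m =
    contradiction (α-injective i q 1≤i (≤-trans i≤m (<⇒≤ m<2m)) (≤-trans (s≤s z≤n) m<q) q≤2m same)
                  (λ { refl → <⇒≱ m<q i≤m })

  β-middle : ∀ b → 1 ≤ b → b ≤ n → β b ≢ n → β b ≢ 1 → 2 ≤ β b × β b ≤ suc d
  β-middle b 1≤b b≤n βb≢n βb≢1 with β-range b 1≤b b≤n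
  ... | 1≤βb , βb≤n = ≤∧≢⇒< 1≤βb (βb≢1 ∘ sym) , s≤s⁻¹ (≤∧≢⇒< βb≤n βb≢n)

  data Pos : ℕ → Level → Set where
    front  : ∀ {p} → 1 ≤ p → p ≤ e → Pos p high
    top    : ∀ {b} → 1 ≤ b → b ≤ n → β b ≡ n → Pos (e + b) high
    inner  : ∀ {b} → 1 ≤ b → b ≤ n → β b ≢ n → β b ≢ 1 → Pos (e + b) mid
    bottom : ∀ {b} → 1 ≤ b → b ≤ n → β b ≡ 1 → Pos (e + b) low
    back   : ∀ {q} → suc m < q → q ≤ 2 * m → Pos (q + d) low

  σ-front : ∀ {p} → p ≤ e → σ p ≡ α p + d
  σ-front {p} p≤e = star-front m n α β p (s≤s p≤e)

  σ-top : ∀ {b} → 1 ≤ b → b ≤ n → β b ≡ n → σ (e + b) ≡ α m + d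
  σ-top {b} 1≤b b≤n βb≡n = trans (star-block e n α β b 1≤b b≤n) (βbar-top m n α β b βb≡n)

  σ-inner : ∀ {b} → 1 ≤ b → b ≤ n → β b ≢ n → β b ≢ 1 → σ (e + b) ≡ β b + e
  σ-inner {b} 1≤b b≤n βb≢n βb≢1 =
    trans (star-block e n α β b 1≤b b≤n) (βbar-inner m n α β b βb≢n βb≢1)

  σ-bottom : ∀ {b} → 1 ≤ b → b ≤ n → β b ≡ 1 → σ (e + b) ≡ α (suc m)
  σ-bottom {b} 1≤b b≤n βb≡1 =
    trans (star-block e n α β b 1≤b b≤n) (βbar-bottom m n α β b (λ ()) βb≡1)

  σ-back : ∀ {q} → suc m < q → σ (q + d) ≡ α q
  σ-back {q} = star-back m d α β q

  shifted-high : ∀ {a} → m < a → a ≤ 2 * m → Band high (a + d)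
  shifted-high {a} m<a a≤2m =
    high (+-monoˡ-< d m<a) (subst (a + d ≤_) (+-comm (2 * m) d) (+-monoˡ-≤ d a≤2m))

  value-band : ∀ {p ℓ} → Pos p ℓ → Band ℓ (σ p)
  value-band (front {p} 1≤p p≤e) rewrite σ-front p≤e =
    uncurry shifted-high (α-high p 1≤p (≤-trans p≤e (n≤1+n e)))
  value-band (top 1≤b b≤n βb≡n) rewrite σ-top 1≤b b≤n βb≡n =
    uncurry shifted-high (α-high m (s≤s z≤n) ≤-refl)
  value-band (inner {b} 1≤b b≤n βb≢n βb≢1) rewrite σ-inner 1≤b b≤n βb≢n βb≢1
    with 2≤βb , βb≤1+d ← β-middle b 1≤b b≤n βb≢n βb≢1 =
    mid (+-monoˡ-≤ e 2≤βb) (≤-trans (+-monoˡ-≤ e βb≤1+d) (≤-reflexive (cong suc (+-comm d e))))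
  value-band (bottom 1≤b b≤n βb≡1) rewrite σ-bottom 1≤b b≤n βb≡1 =
    uncurry Band.low (α-low (suc m) ≤-refl m<2m)
  value-band (back {q} m+1<q q≤2m) rewrite σ-back m+1<q =
    uncurry Band.low (α-low q (<⇒≤ m+1<q) q≤2m)

  block-pos : ∀ {b} → 1 ≤ b → b ≤ n → ∃ (Pos (e + b))
  block-pos {b} 1≤b b≤n with β b ≟ n | β b ≟ 1
  ... | yes βb≡n | _        = high , top 1≤b b≤n βb≡n
  ... | no βb≢n  | yes βb≡1 = low , bottom 1≤b b≤n βb≡1
  ... | no βb≢n  | no βb≢1  = mid , inner 1≤b b≤n βb≢n βb≢1

  classify : ∀ {p} → 1 ≤ p → p ≤ N → ∃ (Pos p)
  classify {p} 1≤p p≤N with p ≤? e | p ≤? e + n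
  ... | yes p≤e | _ = high , front 1≤p p≤e
  ... | no p≰e  | yes p≤e+n with b , refl ← m≤n⇒∃[o]m+o≡n (<⇒≤ (≰⇒> p≰e)) =
    block-pos (+-cancelˡ-< e 0 b (subst (_< e + b) (sym (+-identityʳ e)) (≰⇒> p≰e)))
              (+-cancelˡ-≤ e b n p≤e+n)
  ... | no _    | no p≰e+n with k , refl ← m≤n⇒∃[o]m+o≡n (≰⇒> p≰e+n) =
    low , subst (λ p → Pos p low) (back-offset e d k) (back (s≤s (s≤s (s≤s (m≤m+n e k)))) q≤2m)
    where
    q≤2m : suc (suc (suc (e + k))) ≤ 2 * m
    q≤2m = +-cancelˡ-≤ d _ _
      (subst (_≤ N) (trans (sym (back-offset e d k)) (+-comm _ d)) p≤N)

  -- Bijectivity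

  ≤e⇒≤2m : ∀ {p} → p ≤ e → p ≤ 2 * m
  ≤e⇒≤2m p≤e = ≤-trans p≤e (≤-trans (n≤1+n e) (<⇒≤ m<2m))

  σ-injective-on : ∀ {p p′ ℓ} → Pos p ℓ → Pos p′ ℓ → σ p ≡ σ p′ → p ≡ p′
  σ-injective-on (front 1≤p p≤e) (front 1≤p′ p′≤e) eq =
    α-injective _ _ 1≤p (≤e⇒≤2m p≤e) 1≤p′ (≤e⇒≤2m p′≤e)
      (+-cancelʳ-≡ d _ _ (trans (sym (σ-front p≤e)) (trans eq (σ-front p′≤e))))
  σ-injective-on (front 1≤p p≤e) (top 1≤b b≤n βb≡n) eq =
    contradiction (α-injective _ _ 1≤p (≤e⇒≤2m p≤e) (s≤s z≤n) (<⇒≤ m<2m)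
                    (+-cancelʳ-≡ d _ _ (trans (sym (σ-front p≤e)) (trans eq (σ-top 1≤b b≤n βb≡n)))))
                  (<⇒≢ (s≤s p≤e))
  σ-injective-on c@(top _ _ _) c′@(front _ _) eq = sym (σ-injective-on c′ c (sym eq))
  σ-injective-on (top 1≤b b≤n βb≡n) (top 1≤b′ b′≤n βb′≡n) _ =
    cong (e +_) (β-injective _ _ 1≤b b≤n 1≤b′ b′≤n (trans βb≡n (sym βb′≡n)))
  σ-injective-on (inner 1≤b b≤n βb≢n βb≢1) (inner 1≤b′ b′≤n βb′≢n βb′≢1) eq =
    cong (e +_) (β-injective _ _ 1≤b b≤n 1≤b′ b′≤n (+-cancelʳ-≡ e _ _
      (trans (sym (σ-inner 1≤b b≤n βb≢n βb≢1)) (trans eq (σ-inner 1≤b′ b′≤n βb′≢n βb′≢1)))))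
  σ-injective-on (bottom 1≤b b≤n βb≡1) (bottom 1≤b′ b′≤n βb′≡1) _ =
    cong (e +_) (β-injective _ _ 1≤b b≤n 1≤b′ b′≤n (trans βb≡1 (sym βb′≡1)))
  σ-injective-on (bottom 1≤b b≤n βb≡1) (back m+1<q q≤2m) eq =
    contradiction (α-injective _ _ (s≤s z≤n) m<2m (≤-trans (s≤s z≤n) m+1<q) q≤2m
                    (trans (sym (σ-bottom 1≤b b≤n βb≡1)) (trans eq (σ-back m+1<q))))
                  (<⇒≢ m+1<q)
  σ-injective-on c@(back _ _) c′@(bottom _ _ _) eq = sym (σ-injective-on c′ c (sym eq))
  σ-injective-on (back m+1<q q≤2m) (back m+1<q′ q′≤2m) eq =
    cong (_+ d) (α-injective _ _ (≤-trans (s≤s z≤n) m+1<q) q≤2m (≤-trans (s≤s z≤n) m+1<q′) q′≤2m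
      (trans (sym (σ-back m+1<q)) (trans eq (σ-back m+1<q′))))

  σ-injective : ∀ p p′ → 1 ≤ p → p ≤ N → 1 ≤ p′ → p′ ≤ N → σ p ≡ σ p′ → p ≡ p′
  σ-injective p p′ 1≤p p≤N 1≤p′ p′≤N eq
    with ℓ , c ← classify 1≤p p≤N | ℓ′ , c′ ← classify 1≤p′ p′≤N
    with refl ← band-unique (value-band c) (subst (Band ℓ′) (sym eq) (value-band c′))
    = σ-injective-on c c′ eq

  σ-perm : IsPerm N σ
  σ-perm = (λ p 1≤p p≤N → band-bounds (value-band (proj₂ (classify 1≤p p≤N)))) , σ-injective

  -- A single cycle

  τ : ℕ → ℕ
  τ v with v ≤? m
  ... | yes _ = v
  ... | no _  = v + d

  τ-low : ∀ {v} → v ≤ m → τ v ≡ v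
  τ-low {v} v≤m with v ≤? m
  ... | yes _  = refl
  ... | no v≰m = contradiction v≤m v≰m

  τ-high : ∀ {v} → m < v → τ v ≡ v + d
  τ-high {v} m<v with v ≤? m
  ... | yes v≤m = contradiction v≤m (<⇒≱ m<v)
  ... | no _    = refl

  block-step : ∀ {b} → 1 ≤ b → b ≤ n → β b ≢ n → β b ≢ 1 → σ (e + b) ≡ e + β b
  block-step 1≤b b≤n βb≢n βb≢1 = trans (σ-inner 1≤b b≤n βb≢n βb≢1) (+-comm _ e)

  block-walk : ∀ {s} k → 1 ≤ s → s ≤ n →
    (∀ i → i < k → iter (suc i) β s ≢ n × iter (suc i) β s ≢ 1) →
    Reaches σ (e + s) (e + iter k β s)
  block-walk zero _ _ _ = reaches-refl
  block-walk {s} (suc k) 1≤s s≤n avoids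
    with 1≤x , x≤n ← iter-closed β-range 1≤s s≤n k
    with βx≢n , βx≢1 ← avoids k ≤-refl
    = subst (Reaches σ (e + s)) (block-step 1≤x x≤n βx≢n βx≢1)
        (reaches-step (block-walk k 1≤s s≤n (λ i i<k → avoids i (m≤n⇒m≤1+n i<k))))

  block-from-start : Reaches σ (e + 1) (α m + d)
  block-from-start
    with k , visit , avoids ← first-visit β (λ ()) (β-cycle n (s≤s z≤n) ≤-refl)
    with 1≤c , c≤n ← iter-closed β-range (s≤s z≤n) (s≤s z≤n) k
    = subst (Reaches σ (e + 1)) (σ-top 1≤c c≤n visit)
        (reaches-step (block-walk k (s≤s z≤n) (s≤s z≤n) (λ i i<k → swap (avoids i i<k))))

  n-reaches-1 : Reaches β n 1
  n-reaches-1 = reaches-sym β-perm (s≤s z≤n) (s≤s z≤n) (β-cycle n (s≤s z≤n) ≤-refl)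

  block-from-end : Reaches σ (e + n) (α (suc m))
  block-from-end
    with k , visit , avoids ← first-visit β (λ ()) n-reaches-1
    with 1≤c , c≤n ← iter-closed β-range (s≤s z≤n) ≤-refl k
    = subst (Reaches σ (e + n)) (σ-bottom 1≤c c≤n visit)
        (reaches-step (block-walk k (s≤s z≤n) ≤-refl avoids))

  σ∘τ-front : ∀ {y} → 1 ≤ y → y ≤ e → σ (τ y) ≡ τ (α y)
  σ∘τ-front {y} 1≤y y≤e = begin
    σ (τ y)    ≡⟨ cong σ (τ-low (≤-trans y≤e (n≤1+n e))) ⟩
    σ y        ≡⟨ σ-front y≤e ⟩
    α y + d    ≡⟨ τ-high (proj₁ (α-high y 1≤y (≤-trans y≤e (n≤1+n e)))) ⟨
    τ (α y)    ∎
    where open ≡-Reasoning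

  σ∘τ-back : ∀ {y} → suc m < y → y ≤ 2 * m → σ (τ y) ≡ τ (α y)
  σ∘τ-back {y} m+1<y y≤2m = begin
    σ (τ y)    ≡⟨ cong σ (τ-high (<⇒≤ m+1<y)) ⟩
    σ (y + d)  ≡⟨ σ-back m+1<y ⟩
    α y        ≡⟨ τ-low (proj₂ (α-low y (<⇒≤ m+1<y) y≤2m)) ⟨
    τ (α y)    ∎
    where open ≡-Reasoning

  τ-start : τ m ≡ e + 1
  τ-start = trans (τ-low ≤-refl) (+-comm 1 e)

  τ-end : τ (suc m) ≡ e + n
  τ-end = trans (τ-high ≤-refl) (sym e+n≡m+1+d)

  detour-start : Reaches σ (τ m) (τ (α m))
  detour-start = subst₂ (Reaches σ) (sym τ-start)
    (sym (τ-high (proj₁ (α-high m (s≤s z≤n) ≤-refl)))) block-from-start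

  detour-end : Reaches σ (τ (suc m)) (τ (α (suc m)))
  detour-end = subst₂ (Reaches σ) (sym τ-end)
    (sym (τ-low (proj₂ (α-low (suc m) ≤-refl m<2m)))) block-from-end

  τ-step : ∀ y → 1 ≤ y → y ≤ 2 * m → Reaches σ (τ y) (τ (α y))
  τ-step y 1≤y y≤2m with y ≤? e | y ≤? suc m
  ... | yes y≤e | _         = 1 , σ∘τ-front 1≤y y≤e
  ... | no _    | no y≰m+1  = 1 , σ∘τ-back (≰⇒> y≰m+1) y≤2m
  ... | no y≰e  | yes y≤m+1 with m≤n⇒m<n∨m≡n y≤m+1
  ...   | inj₂ refl = detour-end
  ...   | inj₁ y≤m with refl ← ≤-antisym (s≤s⁻¹ y≤m) (≰⇒> y≰e) = detour-start

  α-orbit-reached : ∀ k → Reaches σ 1 (τ (iter k α 1))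
  α-orbit-reached zero = subst (Reaches σ 1) (sym (τ-low (s≤s z≤n))) reaches-refl
  α-orbit-reached (suc k)
    with 1≤y , y≤2m ← iter-closed α-range (s≤s z≤n) (≤-trans (s≤s z≤n) m<2m) k
    = reaches-trans (α-orbit-reached k) (τ-step _ 1≤y y≤2m)

  α-letters-reached : ∀ y → 1 ≤ y → y ≤ 2 * m → Reaches σ 1 (τ y)
  α-letters-reached y 1≤y y≤2m with k , refl ← α-cycle y 1≤y y≤2m = α-orbit-reached k

  block-start-reached : Reaches σ 1 (e + 1)
  block-start-reached = subst (Reaches σ 1) τ-start (α-letters-reached m (s≤s z≤n) (<⇒≤ m<2m))

  block-end-reached : Reaches σ 1 (e + n)
  block-end-reached = subst (Reaches σ 1) τ-end (α-letters-reached (suc m) (s≤s z≤n) m<2m)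

  β-orbit-reached : ∀ j → Reaches σ 1 (e + iter j β 1)
  β-orbit-reached zero = block-start-reached
  β-orbit-reached (suc j)
    with 1≤x , x≤n ← iter-closed β-range (s≤s z≤n) (s≤s z≤n) j
    with β (iter j β 1) ≟ n | β (iter j β 1) ≟ 1
  ... | yes βx≡n | _        = subst (Reaches σ 1) (cong (e +_) (sym βx≡n)) block-end-reached
  ... | no _     | yes βx≡1 = subst (Reaches σ 1) (cong (e +_) (sym βx≡1)) block-start-reached
  ... | no βx≢n  | no βx≢1  = subst (Reaches σ 1) (block-step 1≤x x≤n βx≢n βx≢1)
                                (reaches-step (β-orbit-reached j))

  block-reached : ∀ {b} → 1 ≤ b → b ≤ n → Reaches σ 1 (e + b)
  block-reached 1≤b b≤n with j , refl ← β-cycle _ 1≤b b≤n = β-orbit-reached j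

  reached : ∀ {p ℓ} → Pos p ℓ → Reaches σ 1 p
  reached (front {p} 1≤p p≤e) =
    subst (Reaches σ 1) (τ-low (≤-trans p≤e (n≤1+n e))) (α-letters-reached p 1≤p (≤e⇒≤2m p≤e))
  reached (top 1≤b b≤n _)      = block-reached 1≤b b≤n
  reached (inner 1≤b b≤n _ _)  = block-reached 1≤b b≤n
  reached (bottom 1≤b b≤n _)   = block-reached 1≤b b≤n
  reached (back {q} m+1<q q≤2m) =
    subst (Reaches σ 1) (τ-high (<⇒≤ m+1<q)) (α-letters-reached q (≤-trans (s≤s z≤n) m+1<q) q≤2m)

  σ-cycle : IsCycle N σ
  σ-cycle p 1≤p p≤N = reached (proj₂ (classify 1≤p p≤N))

  -- Avoiding 123

  ordered : ∀ {i j ℓ ℓ′} → Pos i ℓ → Pos j ℓ′ → σ i < σ j → ℓ ≤ᴸ ℓ′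
  ordered ci cj lt = band-mono (<⇒≤ lt) (value-band ci) (value-band cj)

  front<block : ∀ {p b} → p ≤ e → 1 ≤ b → p < e + b
  front<block p≤e 1≤b = ≤-<-trans p≤e (m<m+n e 1≤b)

  block<back : ∀ {b q} → b ≤ n → suc m < q → e + b < q + d
  block<back {q = q} b≤n m+1<q =
    ≤-<-trans (+-monoʳ-≤ e b≤n) (subst (_< q + d) (sym e+n≡m+1+d) (+-monoˡ-< d m+1<q))

  front<back : ∀ {p q} → p ≤ e → suc m < q → p < q + d
  front<back p≤e m+1<q = <-trans (front<block p≤e (s≤s z≤n)) (block<back (s≤s z≤n) m+1<q)

  α-after-front : ∀ {j k ℓ} → Pos k ℓ → high ≤ᴸ ℓ → j ≤ e → j < k →
    ∃ λ a → j < a × a ≤ 2 * m × σ k ≡ α a + d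
  α-after-front (front _ k≤e) _ _ j<k = _ , j<k , ≤e⇒≤2m k≤e , σ-front k≤e
  α-after-front (top 1≤b b≤n βb≡n) _ j≤e _ = m , s≤s j≤e , <⇒≤ m<2m , σ-top 1≤b b≤n βb≡n
  α-after-front (inner _ _ _ _) ()
  α-after-front (bottom _ _ _) ()
  α-after-front (back _ _) ()

  α-before-back : ∀ {i q ℓ} → Pos i ℓ → ℓ ≤ᴸ low → i < q + d → suc m < q →
    ∃ λ a → 1 ≤ a × a < q × σ i ≡ α a
  α-before-back (back m+1<a _) _ i<j _ =
    _ , ≤-trans (s≤s z≤n) m+1<a , +-cancelʳ-< d _ _ i<j , σ-back m+1<a
  α-before-back (bottom 1≤b b≤n βb≡1) _ _ m+1<q = suc m , s≤s z≤n , m+1<q , σ-bottom 1≤b b≤n βb≡1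
  α-before-back (front _ _) ()
  α-before-back (top _ _ _) ()
  α-before-back (inner _ _ _ _) ()

  α-after-back : ∀ {q k ℓ} → Pos k ℓ → suc m < q → q + d < k →
    ∃ λ a → q < a × a ≤ 2 * m × σ k ≡ α a
  α-after-back (back m+1<a a≤2m) _ j<k = _ , +-cancelʳ-< d _ _ j<k , a≤2m , σ-back m+1<a
  α-after-back (front _ k≤e) m+1<q j<k = ⊥-elim (<-asym j<k (front<back k≤e m+1<q))
  α-after-back (top _ b≤n _) m+1<q j<k = ⊥-elim (<-asym j<k (block<back b≤n m+1<q))
  α-after-back (inner _ b≤n _ _) m+1<q j<k = ⊥-elim (<-asym j<k (block<back b≤n m+1<q))
  α-after-back (bottom _ b≤n _) m+1<q j<k = ⊥-elim (<-asym j<k (block<back b≤n m+1<q))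

  no-high-after-top : ∀ {b k ℓ} → 1 ≤ b → b ≤ n → β b ≡ n → Pos k ℓ → high ≤ᴸ ℓ →
    e + b < k → σ (e + b) < σ k → ⊥
  no-high-after-top 1≤b _ _ (front _ k≤e) _ j<k _ = <-asym j<k (front<block k≤e 1≤b)
  no-high-after-top 1≤b b≤n βb≡n (top 1≤b′ b′≤n βb′≡n) _ _ lt =
    <-irrefl (trans (σ-top 1≤b b≤n βb≡n) (sym (σ-top 1≤b′ b′≤n βb′≡n))) lt
  no-high-after-top _ _ _ (inner _ _ _ _) ()
  no-high-after-top _ _ _ (bottom _ _ _) ()
  no-high-after-top _ _ _ (back _ _) ()

  no-low-before-bottom : ∀ {b i ℓ} → 1 ≤ b → b ≤ n → β b ≡ 1 → Pos i ℓ → ℓ ≤ᴸ low →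
    i < e + b → σ i < σ (e + b) → ⊥
  no-low-before-bottom _ b≤n _ (back m+1<q _) _ i<j _ = <-asym i<j (block<back b≤n m+1<q)
  no-low-before-bottom 1≤b b≤n βb≡1 (bottom 1≤b′ b′≤n βb′≡1) _ _ lt =
    <-irrefl (trans (σ-bottom 1≤b′ b′≤n βb′≡1) (sym (σ-bottom 1≤b b≤n βb≡1))) lt
  no-low-before-bottom _ _ _ (front _ _) ()
  no-low-before-bottom _ _ _ (top _ _ _) ()
  no-low-before-bottom _ _ _ (inner _ _ _ _) ()

  β-before-inner : ∀ {b i ℓ} → 1 ≤ b → b ≤ n → β b ≢ n → β b ≢ 1 → Pos i ℓ → ℓ ≤ᴸ mid →
    i < e + b → σ i < σ (e + b) → ∃ λ c → 1 ≤ c × c < b × β c < β b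
  β-before-inner {b} 1≤b b≤n βb≢n βb≢1 (bottom 1≤c _ βc≡1) _ i<j _ =
    _ , 1≤c , +-cancelˡ-< e _ _ i<j ,
    subst (_< β b) (sym βc≡1) (proj₁ (β-middle b 1≤b b≤n βb≢n βb≢1))
  β-before-inner 1≤b b≤n βb≢n βb≢1 (inner 1≤c c≤n βc≢n βc≢1) _ i<j lt =
    _ , 1≤c , +-cancelˡ-< e _ _ i<j ,
    +-cancelʳ-< e _ _ (subst₂ _<_ (σ-inner 1≤c c≤n βc≢n βc≢1) (σ-inner 1≤b b≤n βb≢n βb≢1) lt)
  β-before-inner _ b≤n _ _ (back m+1<q _) _ i<j _ = ⊥-elim (<-asym i<j (block<back b≤n m+1<q))
  β-before-inner _ _ _ _ (front _ _) ()
  β-before-inner _ _ _ _ (top _ _ _) ()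

  β-after-inner : ∀ {b k ℓ} → 1 ≤ b → b ≤ n → β b ≢ n → β b ≢ 1 → Pos k ℓ → mid ≤ᴸ ℓ →
    e + b < k → σ (e + b) < σ k → ∃ λ c → b < c × c ≤ n × β b < β c
  β-after-inner {b} 1≤b b≤n βb≢n βb≢1 (top _ c≤n βc≡n) _ j<k _ =
    _ , +-cancelˡ-< e _ _ j<k , c≤n ,
    subst (β b <_) (sym βc≡n) (s≤s (proj₂ (β-middle b 1≤b b≤n βb≢n βb≢1)))
  β-after-inner 1≤b b≤n βb≢n βb≢1 (inner 1≤c c≤n βc≢n βc≢1) _ j<k lt =
    _ , +-cancelˡ-< e _ _ j<k , c≤n ,
    +-cancelʳ-< e _ _ (subst₂ _<_ (σ-inner 1≤b b≤n βb≢n βb≢1) (σ-inner 1≤c c≤n βc≢n βc≢1) lt)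
  β-after-inner 1≤b _ _ _ (front _ k≤e) _ j<k _ = ⊥-elim (<-asym j<k (front<block k≤e 1≤b))
  β-after-inner _ _ _ _ (bottom _ _ _) ()
  β-after-inner _ _ _ _ (back _ _) ()

  no-123 : ∀ {i j k ℓ ℓ′ ℓ″} → 1 ≤ i → Pos i ℓ → Pos j ℓ′ → Pos k ℓ″ →
    i < j → j < k → σ i < σ j → σ j < σ k → ⊥
  no-123 1≤i ci cj@(front _ j≤e) ck i<j j<k lt₁ lt₂
    with a , j<a , a≤2m , σk≡αa+d ← α-after-front ck (ordered cj ck lt₂) j≤e j<k
    = α-avoids (_ , _ , a , 1≤i , i<j , j<a , a≤2m ,
        +-cancelʳ-< d _ _ (subst₂ _<_ (σ-front (≤-trans (<⇒≤ i<j) j≤e)) (σ-front j≤e) lt₁) ,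
        +-cancelʳ-< d _ _ (subst₂ _<_ (σ-front j≤e) σk≡αa+d lt₂))
  no-123 _ ci cj@(back m+1<q _) ck i<j j<k lt₁ lt₂
    with a , 1≤a , a<q , σi≡αa ← α-before-back ci (ordered ci cj lt₁) i<j m+1<q
    with a′ , q<a′ , a′≤2m , σk≡αa′ ← α-after-back ck m+1<q j<k
    = α-avoids (a , _ , a′ , 1≤a , a<q , q<a′ , a′≤2m ,
        subst₂ _<_ σi≡αa (σ-back m+1<q) lt₁ , subst₂ _<_ (σ-back m+1<q) σk≡αa′ lt₂)
  no-123 _ _ cj@(top 1≤b b≤n βb≡n) ck _ j<k _ lt₂ =
    no-high-after-top 1≤b b≤n βb≡n ck (ordered cj ck lt₂) j<k lt₂
  no-123 _ ci cj@(bottom 1≤b b≤n βb≡1) _ i<j _ lt₁ _ =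
    no-low-before-bottom 1≤b b≤n βb≡1 ci (ordered ci cj lt₁) i<j lt₁
  no-123 _ ci cj@(inner 1≤b b≤n βb≢n βb≢1) ck i<j j<k lt₁ lt₂
    with c , 1≤c , c<b , βc<βb ← β-before-inner 1≤b b≤n βb≢n βb≢1 ci (ordered ci cj lt₁) i<j lt₁
    with c′ , b<c′ , c′≤n , βb<βc′ ← β-after-inner 1≤b b≤n βb≢n βb≢1 ck (ordered cj ck lt₂) j<k lt₂
    = β-avoids (c , _ , c′ , 1≤c , c<b , b<c′ , c′≤n , βc<βb , βb<βc′)

  σ-avoids : Avoids123 N σ
  σ-avoids (i , j , k , 1≤i , i<j , j<k , k≤N , lt₁ , lt₂) =
    no-123 1≤i (proj₂ (classify 1≤i i≤N)) (proj₂ (classify 1≤j j≤N)) (proj₂ (classify 1≤k k≤N))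
      i<j j<k lt₁ lt₂
    where
    j≤N : j ≤ N
    j≤N = ≤-trans (<⇒≤ j<k) k≤N
    i≤N : i ≤ N
    i≤N = ≤-trans (<⇒≤ i<j) j≤N
    1≤j : 1 ≤ j
    1≤j = ≤-trans 1≤i (<⇒≤ i<j)
    1≤k : 1 ≤ k
    1≤k = ≤-trans 1≤j (<⇒≤ j<k)

  σ-in-C123 : InC123 N σ
  σ-in-C123 = σ-perm , σ-cycle , σ-avoids

lemma5p3 : (m n : ℕ) → 2 ≤ m → 2 ≤ n → (α β : ℕ → ℕ) →
    InC123 (2 * m) α →
    (∀ i → 1 ≤ i → i ≤ m → suc m ≤ α i × α i ≤ 2 * m) →
    (∀ v → suc m ≤ v → v ≤ 2 * m → ∃ λ i → 1 ≤ i × i ≤ m × α i ≡ v) →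
    InC123 n β →
    InC123 (n + 2 * m ∸ 2) (star m n α β)
-- 2 ≤ m is used only as m ≥ 1 (for m = 1 the construction returns β itself).
lemma5p3 (suc e) (suc (suc d)) (s≤s _) (s≤s (s≤s z≤n)) α β
  (α-perm , α-cycle , α-avoids) α-high α-onto (β-perm , β-cycle , β-avoids) =
  StarOfCycles.σ-in-C123 e d α β α-perm α-cycle α-avoids α-high α-onto β-perm β-cycle β-avoids
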